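{- Let $E$ be the elliptic curve $Y^2=X^3+aX+b$ with $a,b\in\mathbb{Q}$, $4a^3+27b^2\neq0$. There exists an effectively computable constant $c$ depending only on $E$ such that for every integer $n\ge1$ the polynomial $\phi_n$ satisfies $\mathrm{h}(\phi_n)\le cn^2$.
   Context: Division polynomials: $\psi_0=0$, $\psi_1=1$, $\psi_2=2Y$, $\psi_3=3X^4+6aX^2+12bX-a^2$, $\psi_4=4Y(X^6+5aX^4+20bX^3-5a^2X^2-4abX-8b^2-a^3)$, $\psi_{2m+1}=\psi_{m+2}\psi_m^3-\psi_{m-1}\psi_{m+1}^3$ for $m\ge2$, $\psi_{2m}=(2Y)^{ -1}\psi_m(\psi_{m+2}\psi_{m-1}^2-\psi_{m-2}\psi_{m+1}^2)$ for $m\ge3$, all reduced using $Y^2=X^3+aX+b$. For $n\ge1$, $\phi_n=X\psi_n^2-\psi_{n+1}\psi_{n-1}$, reduced using $Y^2=X^3+aX+b$, which is a polynomial in $X$ with rational coefficients. For a non-zero polynomial $f$ with complex coefficients, $H(f)$ is the maximum absolute value of its coefficients and $\mathrm{h}(f)=\max\{0,\log H(f)\}$. -}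

module Defs where

open import Data.Nat as ℕ using (ℕ; zero; suc)
open import Data.Nat.DivMod using (_/_; _%_)
open import Data.Integer using (+_)
open import Data.Rational as Q using (ℚ; 0ℚ; ½)
open import Data.List using (List; []; _∷_; map)
open import Data.Product using (_×_; _,_; proj₁; proj₂)

nat : ℕ → ℚ
nat k = (+ k) Q./ 1

-- Polynomials in X over ℚ, as coefficient lists (constant term first).

Poly : Set
Poly = List ℚ

infixl 6 _⊕_
infixl 7 _⊗_ _·_

_⊕_ : Poly → Poly → Poly
[]      ⊕ q       = q
(c ∷ p) ⊕ []      = c ∷ p
(c ∷ p) ⊕ (d ∷ q) = (c Q.+ d) ∷ (p ⊕ q)

_·_ : ℚ → Poly → Poly
c · p = map (c Q.*_) p

_⊗_ : Poly → Poly → Poly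
[]      ⊗ q = []
(c ∷ p) ⊗ q = (c · q) ⊕ (0ℚ ∷ (p ⊗ q))

⊖_ : Poly → Poly
⊖ p = (Q.- (nat 1)) · p

X* : Poly → Poly
X* p = 0ℚ ∷ p

-- Division (quotient and remainder) by the monic cubic X³ + aX + b.
-- Result: quotient, and remainder r0 + r1 X + r2 X².

divCubic : ℚ → ℚ → Poly → Poly × (ℚ × ℚ × ℚ)
divCubic a b []      = [] , (0ℚ , 0ℚ , 0ℚ)
divCubic a b (c ∷ p) with divCubic a b p
... | q , (r0 , r1 , r2) =
  (r2 ∷ q) , (c Q.- r2 Q.* b , r0 Q.- r2 Q.* a , r1)

quotCubic : ℚ → ℚ → Poly → Poly
quotCubic a b p = proj₁ (divCubic a b p)

-- Elements of ℚ[X,Y]/(Y² - (X³+aX+b)), written uniquely as p + q·Y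
-- with p q ∈ ℚ[X]. All operations below are with respect to fixed a b.

El : Set
El = Poly × Poly

module Curve (a b : ℚ) where

  f : Poly
  f = b ∷ a ∷ 0ℚ ∷ nat 1 ∷ []

  infixl 6 _+E_ _-E_
  infixl 7 _*E_

  _+E_ : El → El → El
  (p₁ , q₁) +E (p₂ , q₂) = (p₁ ⊕ p₂) , (q₁ ⊕ q₂)

  _-E_ : El → El → El
  (p₁ , q₁) -E (p₂ , q₂) = (p₁ ⊕ ⊖ p₂) , (q₁ ⊕ ⊖ q₂)

  -- product, reducing Y² = f
  _*E_ : El → El → El
  (p₁ , q₁) *E (p₂ , q₂) = (p₁ ⊗ p₂ ⊕ q₁ ⊗ q₂ ⊗ f) , (p₁ ⊗ q₂ ⊕ q₁ ⊗ p₂)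

  _³ : El → El
  x ³ = x *E x *E x

  _² : El → El
  x ² = x *E x

  -- multiplication by (2Y)⁻¹ :  (p + qY)/(2Y) = q/2 + (p/f)·Y/2,
  -- using Y⁻¹ = Y/f (exact division whenever the result lies in the ring,
  -- which is the case in the division-polynomial recursion).
  div2Y : El → El
  div2Y (p , q) = (½ · q) , (½ · quotCubic a b p)

  Xel : El
  Xel = (0ℚ ∷ nat 1 ∷ []) , []

  zeroE : El
  zeroE = [] , []

  ψ2 ψ3 ψ4 : El
  ψ2 = [] , (nat 2 ∷ [])
  ψ3 = (Q.- (a Q.* a) ∷ nat 12 Q.* b ∷ nat 6 Q.* a ∷ 0ℚ ∷ nat 3 ∷ []) , []
  ψ4 = [] , (nat 4 · ( (Q.- (nat 8 Q.* b Q.* b) Q.- a Q.* a Q.* a)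
                     ∷ Q.- (nat 4 Q.* a Q.* b)
                     ∷ Q.- (nat 5 Q.* a Q.* a)
                     ∷ nat 20 Q.* b
                     ∷ nat 5 Q.* a
                     ∷ 0ℚ
                     ∷ nat 1 ∷ []))

  -- ψ with explicit fuel; every recursive call is at a strictly smaller
  -- index, so fuel (suc n) suffices to compute ψ n.
  ψf : ℕ → ℕ → El
  ψf zero _ = zeroE
  ψf (suc k) 0 = zeroE
  ψf (suc k) 1 = [ nat 1 ] , []
    where open import Data.List using ([_])
  ψf (suc k) 2 = ψ2
  ψf (suc k) 3 = ψ3
  ψf (suc k) 4 = ψ4
  ψf (suc k) n@(suc (suc (suc (suc (suc _))))) with n % 2
  ... | 1 = let m = n / 2 ; ψ = ψf k in
            ψ (m ℕ.+ 2) *E (ψ m) ³ -E ψ (m ℕ.∸ 1) *E (ψ (m ℕ.+ 1)) ³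
  ... | _ = let m = n / 2 ; ψ = ψf k in
            div2Y (ψ m *E (ψ (m ℕ.+ 2) *E (ψ (m ℕ.∸ 1)) ²
                           -E ψ (m ℕ.∸ 2) *E (ψ (m ℕ.+ 1)) ²))

  ψ : ℕ → El
  ψ n = ψf (suc n) n

  φ : ℕ → El
  φ n = Xel *E (ψ n) ² -E ψ (suc n) *E ψ (n ℕ.∸ 1)

coeffs : El → List ℚ
coeffs (p , q) = p Data.List.++ q
  where import Data.List

phi : ℚ → ℚ → ℕ → El
phi a b n = Curve.φ a b n

disc : ℚ → ℚ → ℚ
disc a b = nat 4 Q.* a Q.* a Q.* a Q.+ nat 27 Q.* b Q.* b

module Submission where

-- Fix T ≥ 2 with |a| + |b| ≤ T.  Weight a polynomial p = Σ cᵢ Xⁱ by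
-- N(p) = Σ |cᵢ| Tⁱ, and an element p + qY of ℚ[X,Y]/(Y² − f) by
-- ‖p + qY‖ = N(p) + T² N(q), i.e. Y is given weight T².  N is subadditive
-- and submultiplicative; since N(f) ≤ T⁴ the same holds for ‖·‖ (WeightedNorm,
-- CurveNorm).  Long division by the monic cubic f yields a quotient of
-- weight at most N(p)/T², so the operation (2Y)⁻¹ used in the even
-- duplication formula does not increase ‖·‖.  If an integer A ≥ 2 bounds ‖X‖, ‖ψ₂‖, ‖ψ₃‖, ‖ψ₄‖, induction
-- through the duplication formulas gives ‖ψₙ‖ ≤ A^((n−1)²): each formula is
-- a difference of two products whose total exponent is at most (n−1)² − 1,
-- and the spare factor A ≥ 2 absorbs the two terms (PowerBounds).  Then
-- ‖φₙ‖ ≤ (A²)^(n²), and every coefficient of φₙ is bounded by ‖φₙ‖.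

open import Defs
import Data.Nat as Nat
import Data.Rational as Rat

module NaturalEmbedding where
  open import Data.Nat as ℕ using (ℕ)
  import Data.Nat.Properties as ℕP
  import Data.Nat.Coprimality as Coprime
  open import Data.Integer as ℤ using (+_; -[1+_])
  import Data.Integer.Properties as ℤP
  open import Data.Rational as Q using (ℚ; mkℚ; _≤_; _+_; _*_)
  import Data.Rational.Properties as QP
  open import Data.List using ([]; _∷_; map)
  open import Data.Nat.ListAction using (sum)
  open import Data.List.Relation.Unary.All as All using (All; []; _∷_)
  open import Relation.Binary.PropositionalEquality

  -- `nat k` is the normalised fraction k/1; this makes `nat` compute.
  nat-canonical : ∀ k → nat k ≡ mkℚ (+ k) 0 (Coprime.sym (Coprime.1-coprimeTo k))
  nat-canonical k = QP.normalize-coprime (Coprime.sym (Coprime.1-coprimeTo k))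

  nat-+ : ∀ x y → nat (x ℕ.+ y) ≡ nat x + nat y
  nat-+ x y rewrite nat-canonical x | nat-canonical y =
    cong (λ z → z Q./ 1) (trans (ℤP.pos-+ x y)
      (sym (cong₂ ℤ._+_ (ℤP.*-identityʳ (+ x)) (ℤP.*-identityʳ (+ y)))))

  nat-* : ∀ x y → nat (x ℕ.* y) ≡ nat x * nat y
  nat-* x y rewrite nat-canonical x | nat-canonical y = cong (λ z → z Q./ 1) (ℤP.pos-* x y)

  nat-mono : ∀ {x y} → x ℕ.≤ y → nat x ≤ nat y
  nat-mono {x} {y} x≤y rewrite nat-canonical x | nat-canonical y =
    Q.*≤* (ℤP.*-monoʳ-≤-nonNeg (+ 1) (ℤ.+≤+ x≤y))

  upperℕ : ℚ → ℕ
  upperℕ (mkℚ (+ n) _ _)    = n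
  upperℕ (mkℚ -[1+ _ ] _ _) = 0

  ≤-upperℕ : ∀ q → q ≤ nat (upperℕ q)
  ≤-upperℕ (mkℚ (+ n) d c) rewrite nat-canonical n =
    Q.*≤* (ℤP.*-monoˡ-≤-nonNeg (+ n) (ℤ.+≤+ (ℕ.s≤s ℕ.z≤n)))
  ≤-upperℕ (mkℚ -[1+ n ] d c) rewrite nat-canonical 0 =
    Q.*≤* (subst (ℤ._≤ + 0) (sym (ℤP.*-identityʳ -[1+ n ])) ℤ.-≤+)

  ≤-upperℕ-sum : ∀ k xs → All (λ x → x ≤ nat (k ℕ.+ sum (map upperℕ xs))) xs
  ≤-upperℕ-sum k []       = []
  ≤-upperℕ-sum k (x ∷ xs) =
    QP.≤-trans (≤-upperℕ x)
      (nat-mono (ℕP.≤-trans (ℕP.m≤m+n (upperℕ x) _) (ℕP.m≤n+m _ k)))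
    ∷ All.map (λ {y} → subst (λ z → y ≤ nat z) (ℕP.+-assoc k (upperℕ x) _))
              (≤-upperℕ-sum (k ℕ.+ upperℕ x) xs)

module RationalArithmetic where
  open import Data.Rational as Q using (ℚ; 0ℚ; 1ℚ; _≤_; _+_; _*_)
  import Data.Rational.Properties as QP
  open import Level using (0ℓ)
  open import Relation.Nullary.Decidable using (dec⇒maybe)
  import Tactic.RingSolver.Core.AlmostCommutativeRing as ACR
  open import Relation.Binary.PropositionalEquality

  ℚ-ring : ACR.AlmostCommutativeRing 0ℓ 0ℓ
  ℚ-ring = ACR.fromCommutativeRing QP.+-*-commutativeRing (λ x → dec⇒maybe (0ℚ QP.≟ x))

  0≤+ : ∀ {x y} → 0ℚ ≤ x → 0ℚ ≤ y → 0ℚ ≤ x + y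
  0≤+ = QP.+-mono-≤

  0≤* : ∀ {x y} → 0ℚ ≤ x → 0ℚ ≤ y → 0ℚ ≤ x * y
  0≤* {x} {y} 0≤x 0≤y =
    QP.nonNegative⁻¹ (x * y) {{QP.nonNeg*nonNeg⇒nonNeg x {{Q.nonNegative 0≤x}} y {{Q.nonNegative 0≤y}}}}

  *-monoˡ-≤⁺ : ∀ {r x y} → 0ℚ ≤ r → x ≤ y → r * x ≤ r * y
  *-monoˡ-≤⁺ {r} 0≤r = QP.*-monoˡ-≤-nonNeg r {{Q.nonNegative 0≤r}}

  *-monoʳ-≤⁺ : ∀ {r x y} → 0ℚ ≤ r → x ≤ y → x * r ≤ y * r
  *-monoʳ-≤⁺ {r} 0≤r = QP.*-monoʳ-≤-nonNeg r {{Q.nonNegative 0≤r}}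

  *-mono-≤⁺ : ∀ {x y u v} → 0ℚ ≤ x → 0ℚ ≤ u → x ≤ y → u ≤ v → x * u ≤ y * v
  *-mono-≤⁺ 0≤x 0≤u x≤y u≤v =
    QP.≤-trans (*-monoʳ-≤⁺ 0≤u x≤y) (*-monoˡ-≤⁺ (QP.≤-trans 0≤x x≤y) u≤v)

  x≤x+y : ∀ {x y} → 0ℚ ≤ y → x ≤ x + y
  x≤x+y {x} 0≤y = QP.≤-trans (QP.≤-reflexive (sym (QP.+-identityʳ x))) (QP.+-monoʳ-≤ x 0≤y)

  y≤x+y : ∀ {x y} → 0ℚ ≤ x → y ≤ x + y
  y≤x+y {x} {y} 0≤x = QP.≤-trans (QP.≤-reflexive (sym (QP.+-identityˡ y))) (QP.+-monoˡ-≤ y 0≤x)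

  x≤y*x : ∀ {x y} → 0ℚ ≤ x → 1ℚ ≤ y → x ≤ y * x
  x≤y*x {x} 0≤x 1≤y = QP.≤-trans (QP.≤-reflexive (sym (QP.*-identityˡ x))) (*-monoʳ-≤⁺ 0≤x 1≤y)

module WeightedNorm (T : Rat.ℚ) (0≤T : Rat.0ℚ Rat.≤ T) where
  open import Data.Rational as Q using (ℚ; 0ℚ; 1ℚ; ∣_∣; _≤_; _+_; _*_)
  open import Data.Rational.Properties as QP using (≤-trans; ≤-reflexive)
  open import Data.List using ([]; _∷_)
  open import Data.List.Relation.Unary.All as All using (All; []; _∷_)
  open import Tactic.RingSolver using (solve-∀)
  open import Relation.Binary.PropositionalEquality
  open RationalArithmetic
  open QP.≤-Reasoning

  -- Horner form of Σ |cᵢ| Tⁱ.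
  N : Poly → ℚ
  N []      = 0ℚ
  N (c ∷ p) = ∣ c ∣ + T * N p

  N-nonNeg : ∀ p → 0ℚ ≤ N p
  N-nonNeg []      = QP.≤-refl
  N-nonNeg (c ∷ p) = 0≤+ (QP.0≤∣p∣ c) (0≤* 0≤T (N-nonNeg p))

  N-⊕ : ∀ p q → N (p ⊕ q) ≤ N p + N q
  N-⊕ []      q       = ≤-reflexive (sym (QP.+-identityˡ (N q)))
  N-⊕ (c ∷ p) []      = ≤-reflexive (sym (QP.+-identityʳ (N (c ∷ p))))
  N-⊕ (c ∷ p) (d ∷ q) = begin
    ∣ c + d ∣ + T * N (p ⊕ q)            ≤⟨ QP.+-mono-≤ (QP.∣p+q∣≤∣p∣+∣q∣ c d) (*-monoˡ-≤⁺ 0≤T (N-⊕ p q)) ⟩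
    (∣ c ∣ + ∣ d ∣) + T * (N p + N q)    ≡⟨ regroup (∣ c ∣) (∣ d ∣) T (N p) (N q) ⟩
    (∣ c ∣ + T * N p) + (∣ d ∣ + T * N q) ∎
    where
    regroup : ∀ x y t u v → (x + y) + t * (u + v) ≡ (x + t * u) + (y + t * v)
    regroup = solve-∀ ℚ-ring

  N-· : ∀ c p → N (c · p) ≡ ∣ c ∣ * N p
  N-· c []      = sym (QP.*-zeroʳ ∣ c ∣)
  N-· c (d ∷ p) = begin-equality
    ∣ c * d ∣ + T * N (c · p)           ≡⟨ cong₂ (λ u v → u + T * v) (QP.∣p*q∣≡∣p∣*∣q∣ c d) (N-· c p) ⟩
    ∣ c ∣ * ∣ d ∣ + T * (∣ c ∣ * N p)  ≡⟨ factor (∣ c ∣) (∣ d ∣) T (N p) ⟩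
    ∣ c ∣ * (∣ d ∣ + T * N p)           ∎
    where
    factor : ∀ x y t u → x * y + t * (x * u) ≡ x * (y + t * u)
    factor = solve-∀ ℚ-ring

  N-⊖ : ∀ p → N (⊖ p) ≡ N p
  N-⊖ p = trans (N-· (Q.- nat 1) p) (QP.*-identityˡ (N p))

  N-⊗ : ∀ p q → N (p ⊗ q) ≤ N p * N q
  N-⊗ []      q = ≤-reflexive (sym (QP.*-zeroˡ (N q)))
  N-⊗ (c ∷ p) q = begin
    N (c · q ⊕ (0ℚ ∷ p ⊗ q))               ≤⟨ N-⊕ (c · q) (0ℚ ∷ p ⊗ q) ⟩
    N (c · q) + (0ℚ + T * N (p ⊗ q))        ≡⟨ cong₂ _+_ (N-· c q) (QP.+-identityˡ _) ⟩
    ∣ c ∣ * N q + T * N (p ⊗ q)             ≤⟨ QP.+-monoʳ-≤ (∣ c ∣ * N q) (*-monoˡ-≤⁺ 0≤T (N-⊗ p q)) ⟩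
    ∣ c ∣ * N q + T * (N p * N q)           ≡⟨ factor (∣ c ∣) (N q) T (N p) ⟩
    (∣ c ∣ + T * N p) * N q                 ∎
    where
    factor : ∀ x y t u → x * y + t * (u * y) ≡ (x + t * u) * y
    factor = solve-∀ ℚ-ring

  coefficient≤N : 1ℚ ≤ T → ∀ p → All (λ c → ∣ c ∣ ≤ N p) p
  coefficient≤N 1≤T []      = []
  coefficient≤N 1≤T (c ∷ p) =
    x≤x+y (0≤* 0≤T (N-nonNeg p))
    ∷ All.map (λ h → ≤-trans h (≤-trans (x≤y*x (N-nonNeg p) 1≤T) (y≤x+y (QP.0≤∣p∣ c))))
              (coefficient≤N 1≤T p)

module CurveNorm (a b T : Rat.ℚ) (2≤T : nat 2 Rat.≤ T) (|a|+|b|≤T : Rat.∣ a ∣ Rat.+ Rat.∣ b ∣ Rat.≤ T) where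
  open import Data.Nat as ℕ using (z≤n; s≤s)
  open import Data.Rational as Q using (ℚ; 0ℚ; 1ℚ; ½; ∣_∣; _≤_; _+_; _*_; _-_)
  open import Data.Rational.Properties as QP using (≤-trans; ≤-reflexive)
  open import Data.Product using (_×_; _,_; proj₂)
  open import Data.List using ([]; _∷_)
  open import Data.List.Relation.Unary.All as All using (All)
  open import Data.List.Relation.Unary.All.Properties using (++⁺)
  open import Relation.Nullary.Decidable using (toWitness)
  open import Data.Unit using (tt)
  open import Tactic.RingSolver using (solve-∀)
  open import Relation.Binary.PropositionalEquality
  open NaturalEmbedding
  open RationalArithmetic
  open Curve a b
  open QP.≤-Reasoning

  0≤T : 0ℚ ≤ T
  0≤T = ≤-trans (nat-mono {0} {2} z≤n) 2≤T

  1≤T : 1ℚ ≤ T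
  1≤T = ≤-trans (nat-mono {1} {2} (s≤s z≤n)) 2≤T

  open WeightedNorm T 0≤T

  -- the weight of Y
  K : ℚ
  K = T * T

  0≤K : 0ℚ ≤ K
  0≤K = 0≤* 0≤T 0≤T

  1≤K : 1ℚ ≤ K
  1≤K = *-mono-≤⁺ (QP.nonNegative⁻¹ 1ℚ) (QP.nonNegative⁻¹ 1ℚ) 1≤T 1≤T

  x+x≤T*x : ∀ {x} → 0ℚ ≤ x → x + x ≤ T * x
  x+x≤T*x {x} 0≤x = begin
    x + x        ≡⟨ double x ⟩
    nat 2 * x    ≤⟨ *-monoʳ-≤⁺ 0≤x 2≤T ⟩
    T * x        ∎
    where
    double : ∀ x → x + x ≡ (1ℚ + 1ℚ) * x
    double = solve-∀ ℚ-ring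

  f-tail≤K : ∣ b ∣ + T * ∣ a ∣ ≤ K
  f-tail≤K = begin
    ∣ b ∣ + T * ∣ a ∣       ≤⟨ QP.+-monoˡ-≤ (T * ∣ a ∣) (x≤y*x (QP.0≤∣p∣ b) 1≤T) ⟩
    T * ∣ b ∣ + T * ∣ a ∣   ≡⟨ factor T (∣ a ∣) (∣ b ∣) ⟩
    T * (∣ a ∣ + ∣ b ∣)     ≤⟨ *-monoˡ-≤⁺ 0≤T |a|+|b|≤T ⟩
    K                      ∎
    where
    factor : ∀ t x y → t * y + t * x ≡ t * (x + y)
    factor = solve-∀ ℚ-ring

  -- Y² = f has weight at most K², so Y may consistently be given weight K.
  N-f≤K² : N f ≤ K * K
  N-f≤K² = begin
    N f                                  ≡⟨ expand (∣ b ∣) (∣ a ∣) T ⟩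
    (∣ b ∣ + T * ∣ a ∣) + T * K          ≤⟨ QP.+-monoˡ-≤ (T * K) (≤-trans f-tail≤K (x≤y*x 0≤K 1≤T)) ⟩
    T * K + T * K                        ≤⟨ x+x≤T*x (0≤* 0≤T 0≤K) ⟩
    T * (T * K)                          ≡⟨ reassociate T ⟩
    K * K                                ∎
    where
    expand : ∀ y x t → y + t * (x + t * (0ℚ + t * (1ℚ + t * 0ℚ))) ≡ (y + t * x) + t * (t * t)
    expand = solve-∀ ℚ-ring
    reassociate : ∀ t → t * (t * (t * t)) ≡ t * t * (t * t)
    reassociate = solve-∀ ℚ-ring

  ‖_‖ : El → ℚ
  ‖ (p , q) ‖ = N p + K * N q

  norm-nonNeg : ∀ x → 0ℚ ≤ ‖ x ‖
  norm-nonNeg (p , q) = 0≤+ (N-nonNeg p) (0≤* 0≤K (N-nonNeg q))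

  norm-− : ∀ x y → ‖ x -E y ‖ ≤ ‖ x ‖ + ‖ y ‖
  norm-− (p₁ , q₁) (p₂ , q₂) = begin
    N (p₁ ⊕ ⊖ p₂) + K * N (q₁ ⊕ ⊖ q₂)
      ≤⟨ QP.+-mono-≤ (N-⊕ p₁ (⊖ p₂)) (*-monoˡ-≤⁺ 0≤K (N-⊕ q₁ (⊖ q₂))) ⟩
    (N p₁ + N (⊖ p₂)) + K * (N q₁ + N (⊖ q₂))
      ≡⟨ cong₂ (λ u v → (N p₁ + u) + K * (N q₁ + v)) (N-⊖ p₂) (N-⊖ q₂) ⟩
    (N p₁ + N p₂) + K * (N q₁ + N q₂)
      ≡⟨ regroup K (N p₁) (N p₂) (N q₁) (N q₂) ⟩
    (N p₁ + K * N q₁) + (N p₂ + K * N q₂) ∎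
    where
    regroup : ∀ k u₁ u₂ v₁ v₂ → (u₁ + u₂) + k * (v₁ + v₂) ≡ (u₁ + k * v₁) + (u₂ + k * v₂)
    regroup = solve-∀ ℚ-ring

  norm-* : ∀ x y → ‖ x *E y ‖ ≤ ‖ x ‖ * ‖ y ‖
  norm-* (p₁ , q₁) (p₂ , q₂) = begin
    N (p₁ ⊗ p₂ ⊕ q₁ ⊗ q₂ ⊗ f) + K * N (p₁ ⊗ q₂ ⊕ q₁ ⊗ p₂)
      ≤⟨ QP.+-mono-≤ (≤-trans (N-⊕ (p₁ ⊗ p₂) (q₁ ⊗ q₂ ⊗ f)) (QP.+-mono-≤ (N-⊗ p₁ p₂) Y²-part))
                     (*-monoˡ-≤⁺ 0≤K (≤-trans (N-⊕ (p₁ ⊗ q₂) (q₁ ⊗ p₂))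
                                             (QP.+-mono-≤ (N-⊗ p₁ q₂) (N-⊗ q₁ p₂)))) ⟩
    (N p₁ * N p₂ + N q₁ * N q₂ * (K * K)) + K * (N p₁ * N q₂ + N q₁ * N p₂)
      ≡⟨ expand K (N p₁) (N p₂) (N q₁) (N q₂) ⟩
    (N p₁ + K * N q₁) * (N p₂ + K * N q₂) ∎
    where
    Y²-part : N (q₁ ⊗ q₂ ⊗ f) ≤ N q₁ * N q₂ * (K * K)
    Y²-part = ≤-trans (N-⊗ (q₁ ⊗ q₂) f) (*-mono-≤⁺ (N-nonNeg (q₁ ⊗ q₂)) (N-nonNeg f) (N-⊗ q₁ q₂) N-f≤K²)
    expand : ∀ k u₁ u₂ v₁ v₂ →
      (u₁ * u₂ + v₁ * v₂ * (k * k)) + k * (u₁ * v₂ + v₁ * u₂) ≡ (u₁ + k * v₁) * (u₂ + k * v₂)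
    expand = solve-∀ ℚ-ring

  remainderWeight : ℚ × ℚ × ℚ → ℚ
  remainderWeight (r₀ , r₁ , r₂) = ∣ r₀ ∣ + T * (∣ r₁ ∣ + T * ∣ r₂ ∣)

  remainderWeight-nonNeg : ∀ r → 0ℚ ≤ remainderWeight r
  remainderWeight-nonNeg (r₀ , r₁ , r₂) =
    0≤+ (QP.0≤∣p∣ r₀) (0≤* 0≤T (0≤+ (QP.0≤∣p∣ r₁) (0≤* 0≤T (QP.0≤∣p∣ r₂))))

  ∣p-q*r∣≤ : ∀ p q r → ∣ p - q * r ∣ ≤ ∣ p ∣ + ∣ q ∣ * ∣ r ∣
  ∣p-q*r∣≤ p q r = ≤-trans (QP.∣p-q∣≤∣p∣+∣q∣ p (q * r)) (≤-reflexive (cong (∣ p ∣ +_) (QP.∣p*q∣≡∣p∣*∣q∣ q r)))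

  -- One step of long division by f: the new quotient coefficient r₂ costs
  -- weight K, which is paid for by the term r₂X³ of the old remainder.
  divCubic-step : ∀ c r₀ r₁ r₂ →
    K * ∣ r₂ ∣ + remainderWeight (c - r₂ * b , r₀ - r₂ * a , r₁) ≤ ∣ c ∣ + T * remainderWeight (r₀ , r₁ , r₂)
  divCubic-step c r₀ r₁ r₂ = begin
    K * ∣ r₂ ∣ + (∣ c - r₂ * b ∣ + T * (∣ r₀ - r₂ * a ∣ + T * ∣ r₁ ∣))
      ≤⟨ QP.+-monoʳ-≤ (K * ∣ r₂ ∣) (QP.+-mono-≤ (∣p-q*r∣≤ c r₂ b)
            (*-monoˡ-≤⁺ 0≤T (QP.+-monoˡ-≤ (T * ∣ r₁ ∣) (∣p-q*r∣≤ r₀ r₂ a)))) ⟩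
    K * ∣ r₂ ∣ + ((∣ c ∣ + ∣ r₂ ∣ * ∣ b ∣) + T * ((∣ r₀ ∣ + ∣ r₂ ∣ * ∣ a ∣) + T * ∣ r₁ ∣))
      ≡⟨ collect K T (∣ r₂ ∣) (∣ c ∣) (∣ b ∣) (∣ r₀ ∣) (∣ a ∣) (∣ r₁ ∣) ⟩
    (∣ c ∣ + T * (∣ r₀ ∣ + T * ∣ r₁ ∣)) + ∣ r₂ ∣ * (K + (∣ b ∣ + T * ∣ a ∣))
      ≤⟨ QP.+-monoʳ-≤ (∣ c ∣ + T * (∣ r₀ ∣ + T * ∣ r₁ ∣))
            (*-monoˡ-≤⁺ (QP.0≤∣p∣ r₂) (≤-trans (QP.+-monoʳ-≤ K f-tail≤K) (x+x≤T*x 0≤K))) ⟩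
    (∣ c ∣ + T * (∣ r₀ ∣ + T * ∣ r₁ ∣)) + ∣ r₂ ∣ * (T * K)
      ≡⟨ horner T (∣ r₂ ∣) (∣ c ∣) (∣ r₀ ∣) (∣ r₁ ∣) ⟩
    ∣ c ∣ + T * (∣ r₀ ∣ + T * (∣ r₁ ∣ + T * ∣ r₂ ∣)) ∎
    where
    collect : ∀ k t z c' b' x a' y →
      k * z + ((c' + z * b') + t * ((x + z * a') + t * y))
        ≡ (c' + t * (x + t * y)) + z * (k + (b' + t * a'))
    collect = solve-∀ ℚ-ring
    horner : ∀ t z c' x y → (c' + t * (x + t * y)) + z * (t * (t * t)) ≡ c' + t * (x + t * (y + t * z))
    horner = solve-∀ ℚ-ring

  divCubic-weight : ∀ p → let (q , r) = divCubic a b p in K * N q + remainderWeight r ≤ N p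
  divCubic-weight []      = ≤-reflexive (vanish K T)
    where
    vanish : ∀ k t → k * 0ℚ + (0ℚ + t * (0ℚ + t * 0ℚ)) ≡ 0ℚ
    vanish = solve-∀ ℚ-ring
  divCubic-weight (c ∷ p) with divCubic a b p | divCubic-weight p
  ... | q , (r₀ , r₁ , r₂) | ih = begin
    K * (∣ r₂ ∣ + T * N q) + remainderWeight (c - r₂ * b , r₀ - r₂ * a , r₁)
      ≡⟨ shift K T (∣ r₂ ∣) (N q) (remainderWeight (c - r₂ * b , r₀ - r₂ * a , r₁)) ⟩
    T * (K * N q) + (K * ∣ r₂ ∣ + remainderWeight (c - r₂ * b , r₀ - r₂ * a , r₁))
      ≤⟨ QP.+-monoʳ-≤ (T * (K * N q)) (divCubic-step c r₀ r₁ r₂) ⟩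
    T * (K * N q) + (∣ c ∣ + T * remainderWeight (r₀ , r₁ , r₂))
      ≡⟨ unshift T (K * N q) (∣ c ∣) (remainderWeight (r₀ , r₁ , r₂)) ⟩
    ∣ c ∣ + T * (K * N q + remainderWeight (r₀ , r₁ , r₂))
      ≤⟨ QP.+-monoʳ-≤ ∣ c ∣ (*-monoˡ-≤⁺ 0≤T ih) ⟩
    ∣ c ∣ + T * N p ∎
    where
    shift : ∀ k t z n w → k * (z + t * n) + w ≡ t * (k * n) + (k * z + w)
    shift = solve-∀ ℚ-ring
    unshift : ∀ t m c' w → t * m + (c' + t * w) ≡ c' + t * (m + w)
    unshift = solve-∀ ℚ-ring

  quotCubic-shrinks : ∀ p → K * N (quotCubic a b p) ≤ N p
  quotCubic-shrinks p = ≤-trans (x≤x+y (remainderWeight-nonNeg (proj₂ (divCubic a b p)))) (divCubic-weight p)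

  norm-div2Y : ∀ x → ‖ div2Y x ‖ ≤ ‖ x ‖
  norm-div2Y (p , q) = begin
    N (½ · q) + K * N (½ · quotCubic a b p)
      ≡⟨ cong₂ (λ u v → u + K * v) (N-· ½ q) (N-· ½ (quotCubic a b p)) ⟩
    ½ * N q + K * (½ * N (quotCubic a b p))
      ≤⟨ QP.+-mono-≤ (half≤ (N-nonNeg q)) (*-monoˡ-≤⁺ 0≤K (half≤ (N-nonNeg (quotCubic a b p)))) ⟩
    N q + K * N (quotCubic a b p)
      ≤⟨ QP.+-mono-≤ (x≤y*x (N-nonNeg q) 1≤K) (quotCubic-shrinks p) ⟩
    K * N q + N p
      ≡⟨ QP.+-comm (K * N q) (N p) ⟩
    N p + K * N q ∎
    where
    half≤ : ∀ {x} → 0ℚ ≤ x → ½ * x ≤ x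
    half≤ {x} 0≤x = ≤-trans (*-monoʳ-≤⁺ 0≤x (toWitness {a? = ½ Q.≤? 1ℚ} tt)) (≤-reflexive (QP.*-identityˡ x))

  coeffs≤norm : ∀ x → All (λ c → ∣ c ∣ ≤ ‖ x ‖) (coeffs x)
  coeffs≤norm (p , q) = ++⁺
    (All.map (λ h → ≤-trans h (x≤x+y (0≤* 0≤K (N-nonNeg q)))) (coefficient≤N 1≤T p))
    (All.map (λ h → ≤-trans h (≤-trans (x≤y*x (N-nonNeg q) 1≤K) (y≤x+y (N-nonNeg p)))) (coefficient≤N 1≤T q))

module PowerBounds (A : Nat.ℕ) (2≤A : 2 Nat.≤ A) where
  open import Data.Nat
  open import Data.Nat.Properties
  open import Data.Nat.Tactic.RingSolver using (solve-∀)
  open import Relation.Binary.PropositionalEquality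
  open ≤-Reasoning

  instance
    A-nonZero : NonZero A
    A-nonZero = >-nonZero (≤-trans (s≤s z≤n) 2≤A)

  ψBound : ℕ → ℕ
  ψBound n = A ^ ((n ∸ 1) * (n ∸ 1))

  pow-mono : ∀ {e e′} → e ≤ e′ → A ^ e ≤ A ^ e′
  pow-mono = ^-monoʳ-≤ A

  pow-sum : ∀ {e₁ e₂ e} → e₁ ≤ e → e₂ ≤ e → A ^ e₁ + A ^ e₂ ≤ A ^ suc e
  pow-sum {e₁} {e₂} {e} e₁≤e e₂≤e = begin
    A ^ e₁ + A ^ e₂     ≤⟨ +-mono-≤ (pow-mono e₁≤e) (≤-trans (pow-mono e₂≤e) (m≤m+n (A ^ e) 0)) ⟩
    2 * A ^ e           ≤⟨ *-monoˡ-≤ (A ^ e) 2≤A ⟩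
    A ^ suc e           ∎

  pow-square : ∀ x y → A ^ x * (A ^ y * A ^ y) ≡ A ^ (x + (y + y))
  pow-square x y = trans (cong (A ^ x *_) (sym (^-distribˡ-+-* A y y))) (sym (^-distribˡ-+-* A x (y + y)))

  pow-cube : ∀ x y → A ^ x * (A ^ y * A ^ y * A ^ y) ≡ A ^ (x + (y + y + y))
  pow-cube x y = begin-equality
    A ^ x * (A ^ y * A ^ y * A ^ y)   ≡⟨ cong (λ z → A ^ x * (z * A ^ y)) (sym (^-distribˡ-+-* A y y)) ⟩
    A ^ x * (A ^ (y + y) * A ^ y)     ≡⟨ cong (A ^ x *_) (sym (^-distribˡ-+-* A (y + y) y)) ⟩
    A ^ x * A ^ (y + y + y)           ≡⟨ sym (^-distribˡ-+-* A x (y + y + y)) ⟩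
    A ^ (x + (y + y + y))             ∎

  A≤pow : ∀ {e} → 1 ≤ e → A ≤ A ^ e
  A≤pow 1≤e = ≤-trans (≤-reflexive (sym (*-identityʳ A))) (pow-mono 1≤e)

  ≤-with-slack : ∀ {x y} d → d + x ≡ y → x ≤ y
  ≤-with-slack {x} d d+x≡y = subst (x ≤_) d+x≡y (m≤n+m x d)

  -- ψ_{2m+1} = ψ_{m+2} ψ_m³ − ψ_{m−1} ψ_{m+1}³ for m = i + 2: both products
  -- have exponent 4i² + 12i + 12 < (2m)².
  odd-power-bound : ∀ i → let m = 2 + i in
    ψBound (m + 2) * (ψBound m * ψBound m * ψBound m) + ψBound (m ∸ 1) * (ψBound (m + 1) * ψBound (m + 1) * ψBound (m + 1))
      ≤ ψBound (1 + m * 2)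
  odd-power-bound i = begin
    _                               ≡⟨ cong₂ _+_ (pow-cube x₁ y₁) (pow-cube x₂ y₂) ⟩
    A ^ (x₁ + (y₁ + y₁ + y₁)) + A ^ (x₂ + (y₂ + y₂ + y₂))
                                    ≤⟨ pow-sum (≤-reflexive (first i)) (≤-reflexive (second i)) ⟩
    A ^ suc (4 * i * i + 12 * i + 12) ≤⟨ pow-mono (≤-with-slack (4 * i + 3) (gap i)) ⟩
    A ^ ((2 + i) * 2 * ((2 + i) * 2)) ∎
    where
    x₁ = suc (i + 2) * suc (i + 2)
    y₁ = suc i * suc i
    x₂ = i * i
    y₂ = suc (i + 1) * suc (i + 1)
    first : ∀ i → suc (i + 2) * suc (i + 2) + (suc i * suc i + suc i * suc i + suc i * suc i) ≡ 4 * i * i + 12 * i + 12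
    first = solve-∀
    second : ∀ i → i * i + (suc (i + 1) * suc (i + 1) + suc (i + 1) * suc (i + 1) + suc (i + 1) * suc (i + 1))
                   ≡ 4 * i * i + 12 * i + 12
    second = solve-∀
    gap : ∀ i → (4 * i + 3) + suc (4 * i * i + 12 * i + 12) ≡ (2 + i) * 2 * ((2 + i) * 2)
    gap = solve-∀

  -- ψ_{2m} = ψ_m (ψ_{m+2} ψ_{m−1}² − ψ_{m−2} ψ_{m+1}²)/(2Y) for m = i + 3:
  -- both products have exponent 4i² + 16i + 22 < (2m − 1)².
  even-power-bound : ∀ i → let m = 3 + i in
    ψBound m * (ψBound (m + 2) * (ψBound (m ∸ 1) * ψBound (m ∸ 1)) + ψBound (m ∸ 2) * (ψBound (m + 1) * ψBound (m + 1)))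
      ≤ ψBound (m * 2)
  even-power-bound i = begin
    _                               ≡⟨ *-distribˡ-+ (A ^ z) _ _ ⟩
    _                               ≡⟨ cong₂ _+_ (pow-triple z x₁ y₁) (pow-triple z x₂ y₂) ⟩
    A ^ (z + (x₁ + (y₁ + y₁))) + A ^ (z + (x₂ + (y₂ + y₂)))
                                    ≤⟨ pow-sum (≤-reflexive (first i)) (≤-reflexive (second i)) ⟩
    A ^ suc (4 * i * i + 16 * i + 22) ≤⟨ pow-mono (≤-with-slack (4 * i + 2) (gap i)) ⟩
    A ^ (suc ((2 + i) * 2) * suc ((2 + i) * 2)) ∎
    where
    z  = suc (suc i) * suc (suc i)
    x₁ = suc (suc (i + 2)) * suc (suc (i + 2))
    y₁ = suc i * suc i
    x₂ = i * i
    y₂ = suc (suc (i + 1)) * suc (suc (i + 1))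
    pow-triple : ∀ z x y → A ^ z * (A ^ x * (A ^ y * A ^ y)) ≡ A ^ (z + (x + (y + y)))
    pow-triple z x y = trans (cong (A ^ z *_) (pow-square x y)) (sym (^-distribˡ-+-* A z (x + (y + y))))
    first : ∀ i → suc (suc i) * suc (suc i) + (suc (suc (i + 2)) * suc (suc (i + 2)) + (suc i * suc i + suc i * suc i))
                  ≡ 4 * i * i + 16 * i + 22
    first = solve-∀
    second : ∀ i → suc (suc i) * suc (suc i) + (i * i + (suc (suc (i + 1)) * suc (suc (i + 1)) + suc (suc (i + 1)) * suc (suc (i + 1))))
                   ≡ 4 * i * i + 16 * i + 22
    second = solve-∀
    gap : ∀ i → (4 * i + 2) + suc (4 * i * i + 16 * i + 22) ≡ suc ((2 + i) * 2) * suc ((2 + i) * 2)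
    gap = solve-∀

  -- φ_k = X ψ_k² − ψ_{k+1} ψ_{k−1} for k = n + 1: exponents 2n² + 1 and
  -- (n+1)² + (n−1)², both at most 2n² + 2n + 1 < 2k².
  φ-power-bound : ∀ n → let k = suc n in
    A * (ψBound k * ψBound k) + ψBound (suc k) * ψBound n ≤ (A ^ 2) ^ (k * k)
  φ-power-bound n = begin
    A * (A ^ s * A ^ s) + A ^ k² * ψBound n
      ≤⟨ +-monoʳ-≤ (A * (A ^ s * A ^ s)) (*-monoʳ-≤ (A ^ k²) (pow-mono (*-mono-≤ (m∸n≤m n 1) (m∸n≤m n 1)))) ⟩
    A * (A ^ s * A ^ s) + A ^ k² * A ^ s
      ≡⟨ cong₂ _+_ (cong (A *_) (sym (^-distribˡ-+-* A s s))) (sym (^-distribˡ-+-* A k² s)) ⟩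
    A ^ suc (s + s) + A ^ (k² + s)
      ≤⟨ pow-sum (≤-with-slack (2 * n) (first n)) ≤-refl ⟩
    A ^ suc (k² + s)
      ≤⟨ pow-mono (≤-with-slack (2 * n) (gap n)) ⟩
    A ^ (2 * k²)
      ≡⟨ ^-*-assoc A 2 k² ⟨
    (A ^ 2) ^ k² ∎
    where
    s  = n * n
    k² = suc n * suc n
    first : ∀ n → 2 * n + suc (n * n + n * n) ≡ suc n * suc n + n * n
    first = solve-∀
    gap : ∀ n → 2 * n + suc (suc n * suc n + n * n) ≡ 2 * (suc n * suc n)
    gap = solve-∀

module DuplicationFormulas (a b : Rat.ℚ) where
  open import Data.Nat using (ℕ; suc; _+_; _*_; _∸_; s≤s)
  open import Data.Nat.DivMod using (_/_; _%_; m≡m%n+[m/n]*n; m%n<n)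
  open import Data.Product using (_×_; _,_)
  open import Data.Sum using (_⊎_; inj₁; inj₂)
  open import Data.List using (List; []; _∷_)
  open import Relation.Binary.PropositionalEquality
  open Curve a b

  initialData : List El
  initialData = Xel ∷ ψ2 ∷ ψ3 ∷ ψ4 ∷ []

  oddStep : (ℕ → El) → ℕ → El
  oddStep g m = g (m + 2) *E (g m) ³ -E g (m ∸ 1) *E (g (m + 1)) ³

  evenStep : (ℕ → El) → ℕ → El
  evenStep g m = div2Y (g m *E (g (m + 2) *E (g (m ∸ 1)) ² -E g (m ∸ 2) *E (g (m + 1)) ²))

  ψf-unfold : ∀ k j → let n = 5 + j ; m = n / 2 in
    (n ≡ 1 + m * 2 × ψf (suc k) n ≡ oddStep (ψf k) m) ⊎ (n ≡ m * 2 × ψf (suc k) n ≡ evenStep (ψf k) m)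
  ψf-unfold k j with (5 + j) % 2 | m≡m%n+[m/n]*n (5 + j) 2 | m%n<n (5 + j) 2
  ... | 0           | n≡ | _ = inj₂ (n≡ , refl)
  ... | 1           | n≡ | _ = inj₁ (n≡ , refl)
  ... | suc (suc _) | _  | s≤s (s≤s ())

module DivisionPolynomialGrowth
    (a b T : Rat.ℚ) (2≤T : nat 2 Rat.≤ T) (|a|+|b|≤T : Rat.∣ a ∣ Rat.+ Rat.∣ b ∣ Rat.≤ T)
    (A : Nat.ℕ) (2≤A : 2 Nat.≤ A) where
  open import Data.Nat as ℕ using (ℕ; zero; suc; _+_; _*_; _^_; z≤n; s≤s)
  import Data.Nat.Properties as ℕP
  open import Data.Rational as Q using (0ℚ; 1ℚ; _≤_)
  open import Data.Rational.Properties as QP using (≤-trans; ≤-reflexive)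
  open import Data.List using ([]; _∷_)
  open import Tactic.RingSolver using (solve-∀)
  open import Data.List.Relation.Unary.All using (All; []; _∷_)
  open import Data.Product using (_,_)
  open import Data.Sum using (inj₁; inj₂)
  open import Relation.Binary.PropositionalEquality
  open NaturalEmbedding
  open RationalArithmetic
  open Curve a b
  open CurveNorm a b T 2≤T |a|+|b|≤T
  open PowerBounds A 2≤A
  open DuplicationFormulas a b

  -- x ≼ u: the element x has norm at most the natural number u.  Being a
  -- record type, ≼ lets Agda infer x and u from a bound's type.
  infix 4 _≼_
  record _≼_ (x : El) (u : ℕ) : Set where
    constructor bounded
    field norm≤ : ‖ x ‖ ≤ nat u

  open _≼_ public

  InitialBounds : Set
  InitialBounds = All (_≼ A) initialData

  *-bound : ∀ {x y u v} → x ≼ u → y ≼ v → (x *E y) ≼ (u * v)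
  *-bound {x} {y} {u} {v} (bounded x≤u) (bounded y≤v) = bounded
    (≤-trans (norm-* x y) (≤-trans (*-mono-≤⁺ (norm-nonNeg x) (norm-nonNeg y) x≤u y≤v) (≤-reflexive (sym (nat-* u v)))))

  −-bound : ∀ {x y u v} → x ≼ u → y ≼ v → (x -E y) ≼ (u + v)
  −-bound {x} {y} {u} {v} (bounded x≤u) (bounded y≤v) = bounded
    (≤-trans (norm-− x y) (≤-trans (QP.+-mono-≤ x≤u y≤v) (≤-reflexive (sym (nat-+ u v)))))

  ²-bound : ∀ {x u} → x ≼ u → (x ²) ≼ (u * u)
  ²-bound x≼u = *-bound x≼u x≼u

  ³-bound : ∀ {x u} → x ≼ u → (x ³) ≼ (u * u * u)
  ³-bound x≼u = *-bound (²-bound x≼u) x≼u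

  div2Y-bound : ∀ {x u} → x ≼ u → div2Y x ≼ u
  div2Y-bound {x} (bounded x≤u) = bounded (≤-trans (norm-div2Y x) x≤u)

  weaken : ∀ {x u v} → x ≼ u → u ℕ.≤ v → x ≼ v
  weaken (bounded x≤u) u≤v = bounded (≤-trans x≤u (nat-mono u≤v))

  oddStep-bound : ∀ g → (∀ i → g i ≼ ψBound i) → ∀ m → 5 ℕ.≤ 1 + m * 2 → oddStep g m ≼ ψBound (1 + m * 2)
  oddStep-bound g g≼ (suc (suc i)) _ =
    weaken (−-bound (*-bound (g≼ _) (³-bound (g≼ _))) (*-bound (g≼ _) (³-bound (g≼ _)))) (odd-power-bound i)
  oddStep-bound g g≼ 0 (s≤s ())
  oddStep-bound g g≼ 1 (s≤s (s≤s (s≤s ())))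

  evenStep-bound : ∀ g → (∀ i → g i ≼ ψBound i) → ∀ m → 5 ℕ.≤ m * 2 → evenStep g m ≼ ψBound (m * 2)
  evenStep-bound g g≼ (suc (suc (suc i))) _ =
    weaken (div2Y-bound (*-bound (g≼ _) (−-bound (*-bound (g≼ _) (²-bound (g≼ _))) (*-bound (g≼ _) (²-bound (g≼ _))))))
           (even-power-bound i)
  evenStep-bound g g≼ 0 ()
  evenStep-bound g g≼ 1 (s≤s (s≤s ()))
  evenStep-bound g g≼ 2 (s≤s (s≤s (s≤s (s≤s ()))))

  zero-bound : ∀ {u} → zeroE ≼ u
  zero-bound {u} = bounded (≤-trans (≤-reflexive (trans (QP.+-identityˡ (K Q.* 0ℚ)) (QP.*-zeroʳ K))) (nat-mono {0} {u} z≤n))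

  one-bound : ((nat 1 ∷ []) , []) ≼ 1
  one-bound = bounded (≤-reflexive (vanish T K))
    where
    vanish : ∀ t k → (1ℚ Q.+ t Q.* 0ℚ) Q.+ k Q.* 0ℚ ≡ 1ℚ
    vanish = solve-∀ ℚ-ring

  ψf-bound : InitialBounds → ∀ k n → ψf k n ≼ ψBound n
  ψf-bound _ zero    _ = zero-bound
  ψf-bound _ (suc k) 0 = zero-bound
  ψf-bound _ (suc k) 1 = one-bound
  ψf-bound (_ ∷ ψ₂≼ ∷ _ ∷ _ ∷ []) (suc k) 2 = weaken ψ₂≼ (A≤pow {1} (s≤s z≤n))
  ψf-bound (_ ∷ _ ∷ ψ₃≼ ∷ _ ∷ []) (suc k) 3 = weaken ψ₃≼ (A≤pow {4} (s≤s z≤n))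
  ψf-bound (_ ∷ _ ∷ _ ∷ ψ₄≼ ∷ []) (suc k) 4 = weaken ψ₄≼ (A≤pow {9} (s≤s z≤n))
  ψf-bound init (suc k) (suc (suc (suc (suc (suc j))))) with ψf-unfold k j
  ... | inj₁ (n≡ , ψ≡) = subst₂ _≼_ (sym ψ≡) (cong ψBound (sym n≡))
          (oddStep-bound (ψf k) (ψf-bound init k) _ (subst (5 ℕ.≤_) n≡ (ℕP.m≤m+n 5 j)))
  ... | inj₂ (n≡ , ψ≡) = subst₂ _≼_ (sym ψ≡) (cong ψBound (sym n≡))
          (evenStep-bound (ψf k) (ψf-bound init k) _ (subst (5 ℕ.≤_) n≡ (ℕP.m≤m+n 5 j)))

  φ-bound : InitialBounds → ∀ n → 1 ℕ.≤ n → φ n ≼ (A ^ 2) ^ (n * n)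
  φ-bound init@(X≼ ∷ _) (suc n) _ =
    weaken (−-bound (*-bound X≼ (²-bound (ψ≼ (suc n)))) (*-bound (ψ≼ (suc (suc n))) (ψ≼ n))) (φ-power-bound n)
    where
    ψ≼ : ∀ i → ψ i ≼ ψBound i
    ψ≼ i = ψf-bound init (suc i) i

open import Data.Nat using (ℕ; _+_; _*_; _^_; _≤_)
open import Data.Rational as Q using (ℚ; 0ℚ; ∣_∣)
open import Data.List.Relation.Unary.All using (All)
open import Data.Product using (Σ; _,_)
open import Relation.Binary.PropositionalEquality using (_≢_)
open import Data.List using (map)
open import Data.Nat.ListAction using (sum)
import Data.Nat.Properties as ℕP
import Data.Rational.Properties as QP
import Data.List.Relation.Unary.All as All
open import Data.List.Relation.Unary.All.Properties using (map⁻)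
open NaturalEmbedding

-- The bound needs no hypothesis on the discriminant.
lemma3p6 : (a b : ℚ) → disc a b ≢ 0ℚ →
    Σ ℕ (λ C → (n : ℕ) → 1 ≤ n →
      All (λ c → ∣ c ∣ Q.≤ nat (C ^ (n * n))) (coeffs (phi a b n)))
lemma3p6 a b _ = A ^ 2 , λ n 1≤n →
  All.map (λ c≤‖φ‖ → QP.≤-trans c≤‖φ‖ (norm≤ (φ-bound initial n 1≤n))) (coeffs≤norm (phi a b n))
  where
  t : ℕ
  t = upperℕ (∣ a ∣ Q.+ ∣ b ∣)
  T : ℚ
  T = nat (2 + t)
  2≤T : nat 2 Q.≤ T
  2≤T = nat-mono {2} {2 + t} (ℕP.m≤m+n 2 t)
  |a|+|b|≤T : ∣ a ∣ Q.+ ∣ b ∣ Q.≤ T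
  |a|+|b|≤T = QP.≤-trans (≤-upperℕ (∣ a ∣ Q.+ ∣ b ∣)) (nat-mono {t} {2 + t} (ℕP.m≤n+m t 2))
  open CurveNorm a b T 2≤T |a|+|b|≤T
  open DuplicationFormulas a b using (initialData)
  A : ℕ
  A = 2 + sum (map upperℕ (map ‖_‖ initialData))
  open DivisionPolynomialGrowth a b T 2≤T |a|+|b|≤T A (ℕP.m≤m+n 2 _)
  initial : InitialBounds
  initial = All.map bounded (map⁻ (≤-upperℕ-sum 2 (map ‖_‖ initialData)))
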